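{- Let $(b_n)_{n\in\mathbb Z}$ be a lens sequence with constant $\alpha$. Then for every $n$ with $b_n b_{n+1}\neq0$, $$\alpha=\frac{b_{n-1}}{b_n}+\frac{b_{n+2}}{b_{n+1}}.$$
   Context: A lens sequence is a bilateral real sequence $(b_n)_{n\in\mathbb Z}$ obtained from a seed $(a,b,c)$ with $b\neq0$ placed at three consecutive positions, extended in both directions by $b_n=\alpha b_{n-1}-b_{n-2}+\beta$, where $\alpha=\frac{ab+bc+ca}{b^2}-1$ and $\beta=\frac{b^2-ac}{b}$; these constants do not depend on the choice of the three consecutive terms (with nonzero middle term). -}

module Defs where

open import Level using (Level; _⊔_) renaming (suc to lsuc)
open import Algebra.Bundles using (CommutativeRing)
open import Relation.Nullary using (¬_)
open import Data.Integer as ℤ using (ℤ)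

-- A field: a commutative ring with 0 ≠ 1 in which every nonzero element has a
-- multiplicative inverse.  (agda-stdlib has no reals and no Field bundle; the
-- statement is stated over an arbitrary field, which includes ℝ.)
record Field (c ℓ : Level) : Set (lsuc (c ⊔ ℓ)) where
  field
    commutativeRing : CommutativeRing c ℓ
  open CommutativeRing commutativeRing public
  field
    inv         : (x : Carrier) → ¬ (x ≈ 0#) → Carrier
    inv-inverse : (x : Carrier) (p : ¬ (x ≈ 0#)) → x * inv x p ≈ 1#
    0≉1         : ¬ (0# ≈ 1#)

module FieldDefs {c ℓ : Level} (F : Field c ℓ) where
  open Field F

  nz-left : (x y : Carrier) → ¬ (x * y ≈ 0#) → ¬ (x ≈ 0#)
  nz-left x y h x≈0 = h (trans (*-congʳ x≈0) (zeroˡ y))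

  nz-right : (x y : Carrier) → ¬ (x * y ≈ 0#) → ¬ (y ≈ 0#)
  nz-right x y h y≈0 = h (trans (*-congˡ y≈0) (zeroʳ x))

  div : (x y : Carrier) → ¬ (y ≈ 0#) → Carrier
  div x y p = x * inv y p

  lensα : (a b c : Carrier) → ¬ (b ≈ 0#) → Carrier
  lensα a b c p = div (a * b + b * c + c * a) (b * b) (nz-sq p) - 1#
    where
      nz-sq : ¬ (b ≈ 0#) → ¬ (b * b ≈ 0#)
      nz-sq q bb≈0 = q (begin-eq)
        where
          begin-eq : b ≈ 0#
          begin-eq =
            trans (sym (*-identityʳ b))
            (trans (*-congˡ (sym (inv-inverse b q)))
            (trans (sym (*-assoc b b (inv b q)))
            (trans (*-congʳ bb≈0) (zeroˡ (inv b q)))))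

  lensβ : (a b c : Carrier) → ¬ (b ≈ 0#) → Carrier
  lensβ a b c p = div (b * b - a * c) b p

  record LensSequence : Set (c ⊔ ℓ) where
    field
      seq     : ℤ → Carrier
      k       : ℤ
      seed-nz : ¬ (seq (k ℤ.+ ℤ.1ℤ) ≈ 0#)
    α : Carrier
    α = lensα (seq k) (seq (k ℤ.+ ℤ.1ℤ)) (seq (k ℤ.+ ℤ.+ 2)) seed-nz
    β : Carrier
    β = lensβ (seq k) (seq (k ℤ.+ ℤ.1ℤ)) (seq (k ℤ.+ ℤ.+ 2)) seed-nz
    field
      recurrence : (n : ℤ) → seq n ≈ α * seq (n ℤ.- ℤ.1ℤ) - seq (n ℤ.- ℤ.+ 2) + β

{-# OPTIONS --safe #-}
-- The quadratic form Q(x, y) = x² + y² − αxy − β(x + y) takes the same value on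
-- all pairs of consecutive terms: Q(x, y) − Q(y, z) = (x − z)(x + z − αy − β), and
-- the recurrence says x + z = αy + β.  With α, β read off the seed, Q vanishes on
-- the seed, hence everywhere.  For consecutive terms x, y, z, w this gives
-- xz + wy = z(x + z) + y(y + w) − y² − z² = z(αy + β) + y(αz + β) − y² − z²
--         = αyz − Q(y, z) = αyz,
-- and dividing by yz gives α = x/y + w/z.
module Submission where

open import Defs
open import Level using (Level)
open import Relation.Nullary using (¬_; yes; no)
open import Data.Integer as ℤ using (ℤ; +_; -[1+_]; 0ℤ; 1ℤ)
import Data.Integer.Properties as ℤ
open import Data.Integer.Tactic.RingSolver using (solve-∀)
open import Data.Nat as ℕ using (ℕ; zero; suc)
import Data.Nat.Properties as ℕ
open import Data.Maybe using (Maybe; just; nothing)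
open import Data.Sign as Sign using (Sign)
open import Relation.Binary.PropositionalEquality as ≡ using (_≡_)
open import Relation.Binary.Bundles using (Setoid)
open import Algebra.Bundles using (CommutativeRing; RawRing)
open import Algebra.Solver.Ring.AlmostCommutativeRing
  using (_-Raw-AlmostCommutative⟶_; fromCommutativeRing)
import Relation.Binary.Reasoning.Setoid as SetoidReasoning

-- The library's ring solvers need coefficients whose equality is decidable, so
-- that they can cancel; ℤ, mapped in canonically, serves for every commutative ring.
module IntegerCoefficients {c ℓ : Level} (R : CommutativeRing c ℓ) where
  open CommutativeRing R
  -- The optimised multiplication makes 1 × 1# reduce to 1#, so con 1ℤ is 1#.
  open import Algebra.Properties.Semiring.Mult.TCOptimised semiring
    using (_×_; 1+×; ×-homo-+; ×1-homo-*)
  open import Algebra.Properties.Ring ring using (-1*x≈-x)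
  open import Algebra.Properties.AbelianGroup +-abelianGroup
    using (ε⁻¹≈ε; ⁻¹-involutive; ⁻¹-∙-comm)
  open import Algebra.Properties.CommutativeSemigroup *-commutativeSemigroup using (interchange)
  open SetoidReasoning setoid

  fromℕ : ℕ → Carrier
  fromℕ n = n × 1#

  fromℤ : ℤ → Carrier
  fromℤ (+ n)    = fromℕ n
  fromℤ -[1+ n ] = - fromℕ (suc n)

  private
    +-cancelˡ-difference : ∀ a x y → x - y ≈ (a + x) - (a + y)
    +-cancelˡ-difference a x y = begin
      x - y                 ≈⟨ +-identityˡ _ ⟨
      0# + (x - y)          ≈⟨ +-congʳ (-‿inverseʳ a) ⟨
      (a - a) + (x - y)     ≈⟨ +-assoc a (- a) (x - y) ⟩
      a + (- a + (x - y))   ≈⟨ +-congˡ (+-assoc (- a) x (- y)) ⟨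
      a + ((- a + x) - y)   ≈⟨ +-congˡ (+-congʳ (+-comm (- a) x)) ⟩
      a + ((x - a) - y)     ≈⟨ +-congˡ (+-assoc x (- a) (- y)) ⟩
      a + (x + (- a - y))   ≈⟨ +-assoc a x _ ⟨
      (a + x) + (- a - y)   ≈⟨ +-congˡ (⁻¹-∙-comm a y) ⟩
      (a + x) - (a + y)     ∎

  fromℤ-⊖ : ∀ m n → fromℤ (m ℤ.⊖ n) ≈ fromℕ m - fromℕ n
  fromℤ-⊖ m       zero    = trans (sym (+-identityʳ _)) (+-congˡ (sym ε⁻¹≈ε))
  fromℤ-⊖ zero    (suc n) = sym (+-identityˡ _)
  fromℤ-⊖ (suc m) (suc n) = begin
    fromℤ (suc m ℤ.⊖ suc n)                 ≡⟨ ≡.cong fromℤ (ℤ.[1+m]⊖[1+n]≡m⊖n m n) ⟩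
    fromℤ (m ℤ.⊖ n)                         ≈⟨ fromℤ-⊖ m n ⟩
    fromℕ m - fromℕ n                       ≈⟨ +-cancelˡ-difference 1# _ _ ⟩
    (1# + fromℕ m) - (1# + fromℕ n)         ≈⟨ +-cong (1+× m 1#) (-‿cong (1+× n 1#)) ⟨
    fromℕ (suc m) - fromℕ (suc n)           ∎

  fromℤ-+ : ∀ i j → fromℤ (i ℤ.+ j) ≈ fromℤ i + fromℤ j
  fromℤ-+ (+ m)    (+ n)    = ×-homo-+ 1# m n
  fromℤ-+ (+ m)    -[1+ n ] = fromℤ-⊖ m (suc n)
  fromℤ-+ -[1+ m ] (+ n)    = trans (fromℤ-⊖ n (suc m)) (+-comm _ _)
  fromℤ-+ -[1+ m ] -[1+ n ] = begin
    - fromℕ (suc (suc (m ℕ.+ n)))          ≡⟨ ≡.cong (λ k → - fromℕ (suc k)) (ℕ.+-suc m n) ⟨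
    - fromℕ (suc m ℕ.+ suc n)              ≈⟨ -‿cong (×-homo-+ 1# (suc m) (suc n)) ⟩
    - (fromℕ (suc m) + fromℕ (suc n))      ≈⟨ ⁻¹-∙-comm _ _ ⟨
    - fromℕ (suc m) + - fromℕ (suc n)      ∎

  fromℤ-neg : ∀ i → fromℤ (ℤ.- i) ≈ - fromℤ i
  fromℤ-neg (+ zero)  = sym ε⁻¹≈ε
  fromℤ-neg (+ suc n) = refl
  fromℤ-neg -[1+ n ]  = sym (⁻¹-involutive _)

  fromSign : Sign → Carrier
  fromSign Sign.+ = 1#
  fromSign Sign.- = - 1#

  fromSign-* : ∀ s t → fromSign (s Sign.* t) ≈ fromSign s * fromSign t
  fromSign-* Sign.+ t      = sym (*-identityˡ _)
  fromSign-* Sign.- Sign.+ = sym (*-identityʳ _)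
  fromSign-* Sign.- Sign.- = sym (trans (-1*x≈-x _) (⁻¹-involutive _))

  fromℤ-◃ : ∀ s n → fromℤ (s ℤ.◃ n) ≈ fromSign s * fromℕ n
  fromℤ-◃ s       zero    = sym (zeroʳ _)
  fromℤ-◃ Sign.+ (suc n) = sym (*-identityˡ _)
  fromℤ-◃ Sign.- (suc n) = sym (-1*x≈-x _)

  fromℤ-sign-abs : ∀ i → fromℤ i ≈ fromSign (ℤ.sign i) * fromℕ ℤ.∣ i ∣
  fromℤ-sign-abs i = trans (reflexive (≡.cong fromℤ (≡.sym (ℤ.◃-inverse i))))
                           (fromℤ-◃ (ℤ.sign i) ℤ.∣ i ∣)

  fromℤ-* : ∀ i j → fromℤ (i ℤ.* j) ≈ fromℤ i * fromℤ j
  fromℤ-* i j = begin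
    fromℤ (i ℤ.* j)
      ≈⟨ fromℤ-◃ (ℤ.sign i Sign.* ℤ.sign j) (ℤ.∣ i ∣ ℕ.* ℤ.∣ j ∣) ⟩
    fromSign (ℤ.sign i Sign.* ℤ.sign j) * fromℕ (ℤ.∣ i ∣ ℕ.* ℤ.∣ j ∣)
      ≈⟨ *-cong (fromSign-* (ℤ.sign i) (ℤ.sign j)) (×1-homo-* ℤ.∣ i ∣ ℤ.∣ j ∣) ⟩
    (fromSign (ℤ.sign i) * fromSign (ℤ.sign j)) * (fromℕ ℤ.∣ i ∣ * fromℕ ℤ.∣ j ∣)
      ≈⟨ interchange _ _ _ _ ⟩
    (fromSign (ℤ.sign i) * fromℕ ℤ.∣ i ∣) * (fromSign (ℤ.sign j) * fromℕ ℤ.∣ j ∣)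
      ≈⟨ *-cong (fromℤ-sign-abs i) (fromℤ-sign-abs j) ⟨
    fromℤ i * fromℤ j
      ∎

  ℤ-rawRing : RawRing _ _
  ℤ-rawRing = record
    { Carrier = ℤ ; _≈_ = _≡_ ; _+_ = ℤ._+_ ; _*_ = ℤ._*_ ; -_ = ℤ.-_ ; 0# = 0ℤ ; 1# = 1ℤ }

  fromℤ-homomorphism : ℤ-rawRing -Raw-AlmostCommutative⟶ fromCommutativeRing R
  fromℤ-homomorphism = record
    { ⟦_⟧    = fromℤ
    ; +-homo = fromℤ-+
    ; *-homo = fromℤ-*
    ; -‿homo = fromℤ-neg
    ; 0-homo = refl
    ; 1-homo = refl
    }

  fromℤ-≟ : ∀ i j → Maybe (fromℤ i ≈ fromℤ j)
  fromℤ-≟ i j with i ℤ.≟ j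
  ... | yes ≡.refl = just refl
  ... | no _       = nothing

  open import Algebra.Solver.Ring ℤ-rawRing (fromCommutativeRing R) fromℤ-homomorphism fromℤ-≟ public

module _ {a ℓ : Level} (S : Setoid a ℓ) where
  open Setoid S

  shift-invariant⇒constant : (f : ℤ → Carrier) → (∀ i → f i ≈ f (i ℤ.+ 1ℤ)) → ∀ i j → f i ≈ f j
  shift-invariant⇒constant f shift i j = trans (≈-at-0 i) (sym (≈-at-0 j))
    where
      ≈-after : ∀ i m → f (i ℤ.+ + m) ≈ f i
      ≈-after i zero    = reflexive (≡.cong f (ℤ.+-identityʳ i))
      ≈-after i (suc m) = begin
        f (i ℤ.+ (1ℤ ℤ.+ + m))   ≡⟨ ≡.cong f (ℤ.+-assoc i 1ℤ (+ m)) ⟨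
        f (i ℤ.+ 1ℤ ℤ.+ + m)     ≈⟨ ≈-after (i ℤ.+ 1ℤ) m ⟩
        f (i ℤ.+ 1ℤ)             ≈⟨ shift i ⟨
        f i                      ∎
        where open SetoidReasoning S

      ≈-at-0 : ∀ i → f i ≈ f 0ℤ
      ≈-at-0 (+ m)    = ≈-after 0ℤ m
      ≈-at-0 -[1+ m ] = trans (sym (≈-after -[1+ m ] (suc m)))
                              (reflexive (≡.cong f (ℤ.+-inverseˡ (+ suc m))))

module LensAlgebra {c ℓ : Level} (F : Field c ℓ) where
  open Field F
  open FieldDefs F
  open IntegerCoefficients commutativeRing using (solve; _:=_; _:+_; _:*_; _:-_; con)
  open SetoidReasoning setoid

  lensInvariant : (α β x y : Carrier) → Carrier
  lensInvariant α β x y = x * x + y * y - α * x * y - β * (x + y)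

  *-cancelˡ-≈0 : ∀ y → ¬ (y ≈ 0#) → ∀ t → y * t ≈ 0# → t ≈ 0#
  *-cancelˡ-≈0 y y≉0 t yt≈0 = begin
    t                    ≈⟨ *-identityʳ t ⟨
    t * 1#               ≈⟨ *-congˡ (inv-inverse y y≉0) ⟨
    t * (y * inv y y≉0)  ≈⟨ solve 3 (λ t y u → t :* (y :* u) := (y :* t) :* u) refl t y (inv y y≉0) ⟩
    (y * t) * inv y y≉0  ≈⟨ *-congʳ yt≈0 ⟩
    0# * inv y y≉0       ≈⟨ zeroˡ _ ⟩
    0#                   ∎

  lensInvariant-seed : ∀ a b c (b≉0 : ¬ (b ≈ 0#)) →
    lensInvariant (lensα a b c b≉0) (lensβ a b c b≉0) a b ≈ 0#
  lensInvariant-seed a b c b≉0 = *-cancelˡ-≈0 (b * b) bb≉0 _ (begin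
    b * b * lensInvariant α β a b
      ≈⟨ solve 4 (λ a b α β →
           b :* b :* (a :* a :+ b :* b :- α :* a :* b :- β :* (a :+ b))
           := a :* a :* b :* b :+ b :* b :* b :* b :- a :* b :* (b :* b :* α) :- (a :+ b) :* b :* (b :* β))
           refl a b α β ⟩
    a * a * b * b + b * b * b * b - a * b * (b * b * α) - (a + b) * b * (b * β)
      ≈⟨ +-cong (+-congˡ (-‿cong (*-congˡ bbα≈X-bb))) (-‿cong (*-congˡ bβ≈bb-ac)) ⟩
    a * a * b * b + b * b * b * b - a * b * (X - b * b) - (a + b) * b * (b * b - a * c)
      ≈⟨ solve 3 (λ a b c →
           a :* a :* b :* b :+ b :* b :* b :* b :- a :* b :* ((a :* b :+ b :* c :+ c :* a) :- b :* b)
             :- (a :+ b) :* b :* (b :* b :- a :* c)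
           := con 0ℤ)
           refl a b c ⟩
    0# ∎)
    where
      X α β : Carrier
      X = a * b + b * c + c * a
      α = lensα a b c b≉0
      β = lensβ a b c b≉0
      bb≉0 : ¬ (b * b ≈ 0#)
      bb≉0 bb≈0 = b≉0 (*-cancelˡ-≈0 b b≉0 b bb≈0)
      -- Each _ is the proof of b * b ≉ 0 built inside lensα; unification recovers it.
      bbα≈X-bb : b * b * α ≈ X - b * b
      bbα≈X-bb = begin
        b * b * (X * inv (b * b) _ - 1#)
          ≈⟨ solve 3 (λ b X u → b :* b :* (X :* u :- con 1ℤ) := b :* b :* u :* X :- b :* b) refl b X _ ⟩
        b * b * inv (b * b) _ * X - b * b   ≈⟨ +-congʳ (*-congʳ (inv-inverse (b * b) _)) ⟩
        1# * X - b * b                      ≈⟨ +-congʳ (*-identityˡ X) ⟩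
        X - b * b                           ∎
      bβ≈bb-ac : b * β ≈ b * b - a * c
      bβ≈bb-ac = begin
        b * ((b * b - a * c) * inv b b≉0)
          ≈⟨ solve 3 (λ b Y u → b :* (Y :* u) := b :* u :* Y) refl b (b * b - a * c) (inv b b≉0) ⟩
        b * inv b b≉0 * (b * b - a * c)     ≈⟨ *-congʳ (inv-inverse b b≉0) ⟩
        1# * (b * b - a * c)                ≈⟨ *-identityˡ _ ⟩
        b * b - a * c                       ∎

  recurrence⇒sum-of-neighbours : ∀ {α β} x y z → z ≈ α * y - x + β → x + z ≈ α * y + β
  recurrence⇒sum-of-neighbours {α} {β} x y z z≈αy-x+β = begin
    x + z                  ≈⟨ +-congˡ z≈αy-x+β ⟩
    x + (α * y - x + β)    ≈⟨ solve 4 (λ α β x y → x :+ (α :* y :- x :+ β) := α :* y :+ β) refl α β x y ⟩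
    α * y + β              ∎

  lensInvariant-shift : ∀ {α β} x y z → x + z ≈ α * y + β →
    lensInvariant α β x y ≈ lensInvariant α β y z
  lensInvariant-shift {α} {β} x y z x+z≈αy+β = begin
    lensInvariant α β x y
      ≈⟨ solve 5 (λ α β x y z →
           x :* x :+ y :* y :- α :* x :* y :- β :* (x :+ y)
           := (y :* y :+ z :* z :- α :* y :* z :- β :* (y :+ z)) :+ (x :- z) :* ((x :+ z) :- (α :* y :+ β)))
           refl α β x y z ⟩
    lensInvariant α β y z + (x - z) * ((x + z) - (α * y + β))
      ≈⟨ +-congˡ (*-congˡ (+-congʳ x+z≈αy+β)) ⟩
    lensInvariant α β y z + (x - z) * ((α * y + β) - (α * y + β))
      ≈⟨ +-congˡ (trans (*-congˡ (-‿inverseʳ _)) (zeroʳ _)) ⟩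
    lensInvariant α β y z + 0#
      ≈⟨ +-identityʳ _ ⟩
    lensInvariant α β y z ∎

  neighbour-cross-products : ∀ {α β} x y z w → lensInvariant α β y z ≈ 0# →
    x + z ≈ α * y + β → y + w ≈ α * z + β → x * z + w * y ≈ α * (y * z)
  neighbour-cross-products {α} {β} x y z w invariant≈0 x+z≈αy+β y+w≈αz+β = begin
    x * z + w * y
      ≈⟨ solve 4 (λ x y z w → x :* z :+ w :* y := z :* (x :+ z) :+ y :* (y :+ w) :- (y :* y :+ z :* z))
           refl x y z w ⟩
    z * (x + z) + y * (y + w) - (y * y + z * z)
      ≈⟨ +-congʳ (+-cong (*-congˡ x+z≈αy+β) (*-congˡ y+w≈αz+β)) ⟩
    z * (α * y + β) + y * (α * z + β) - (y * y + z * z)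
      ≈⟨ solve 4 (λ α β y z →
           z :* (α :* y :+ β) :+ y :* (α :* z :+ β) :- (y :* y :+ z :* z)
           := α :* (y :* z) :- (y :* y :+ z :* z :- α :* y :* z :- β :* (y :+ z)))
           refl α β y z ⟩
    α * (y * z) - lensInvariant α β y z
      ≈⟨ +-congˡ (-‿cong invariant≈0) ⟩
    α * (y * z) - 0#
      ≈⟨ solve 1 (λ t → t :- con 0ℤ := t) refl _ ⟩
    α * (y * z) ∎

  cross-products⇒quotient-sum : ∀ {α} x y z w u v → y * u ≈ 1# → z * v ≈ 1# →
    x * z + w * y ≈ α * (y * z) → α ≈ x * u + w * v
  cross-products⇒quotient-sum {α} x y z w u v yu≈1 zv≈1 cross = begin
    α                              ≈⟨ solve 1 (λ α → α := α :* (con 1ℤ :* con 1ℤ)) refl α ⟩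
    α * (1# * 1#)                  ≈⟨ *-congˡ (*-cong yu≈1 zv≈1) ⟨
    α * ((y * u) * (z * v))        ≈⟨ solve 5 (λ α y z u v → α :* ((y :* u) :* (z :* v)) := α :* (y :* z) :* (u :* v))
                                        refl α y z u v ⟩
    α * (y * z) * (u * v)          ≈⟨ *-congʳ cross ⟨
    (x * z + w * y) * (u * v)      ≈⟨ solve 6 (λ x y z w u v →
                                          (x :* z :+ w :* y) :* (u :* v) := x :* u :* (z :* v) :+ w :* v :* (y :* u))
                                        refl x y z w u v ⟩
    x * u * (z * v) + w * v * (y * u) ≈⟨ +-cong (*-congˡ zv≈1) (*-congˡ yu≈1) ⟩
    x * u * 1# + w * v * 1#        ≈⟨ +-cong (*-identityʳ _) (*-identityʳ _) ⟩
    x * u + w * v                  ∎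

module LensSequenceProperties {c ℓ : Level} (F : Field c ℓ) (L : FieldDefs.LensSequence F) where
  open Field F
  open FieldDefs F
  open LensSequence L
  open LensAlgebra F

  private
    +1+1-1 : ∀ i → i ℤ.+ 1ℤ ℤ.+ 1ℤ ℤ.- 1ℤ ≡ i ℤ.+ 1ℤ
    +1+1-1 = solve-∀
    +1+1-2 : ∀ i → i ℤ.+ 1ℤ ℤ.+ 1ℤ ℤ.- ℤ.+ 2 ≡ i
    +1+1-2 = solve-∀

  sum-of-neighbours : ∀ {i m j} → m ≡ i ℤ.+ 1ℤ → j ≡ m ℤ.+ 1ℤ → seq i + seq j ≈ α * seq m + β
  sum-of-neighbours {i} ≡.refl ≡.refl = recurrence⇒sum-of-neighbours _ _ _ (begin
    seq (i ℤ.+ 1ℤ ℤ.+ 1ℤ)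
      ≈⟨ recurrence (i ℤ.+ 1ℤ ℤ.+ 1ℤ) ⟩
    α * seq (i ℤ.+ 1ℤ ℤ.+ 1ℤ ℤ.- 1ℤ) - seq (i ℤ.+ 1ℤ ℤ.+ 1ℤ ℤ.- ℤ.+ 2) + β
      ≡⟨ ≡.cong₂ (λ p q → α * seq p - seq q + β) (+1+1-1 i) (+1+1-2 i) ⟩
    α * seq (i ℤ.+ 1ℤ) - seq i + β ∎)
    where open SetoidReasoning setoid

  invariantAt : ℤ → Carrier
  invariantAt m = lensInvariant α β (seq m) (seq (m ℤ.+ 1ℤ))

  invariantAt≈0 : ∀ m → invariantAt m ≈ 0#
  invariantAt≈0 m = trans (shift-invariant⇒constant setoid invariantAt shift m k)
                          (lensInvariant-seed _ _ _ seed-nz)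
    where
      shift : ∀ i → invariantAt i ≈ invariantAt (i ℤ.+ 1ℤ)
      shift i = lensInvariant-shift _ _ _ (sum-of-neighbours ≡.refl ≡.refl)

proposition4p6 : {c ℓ : Level} (F : Field c ℓ) (L : FieldDefs.LensSequence F) (n : ℤ)
  → (h : ¬ (Field._≈_ F (Field._*_ F (FieldDefs.LensSequence.seq L n) (FieldDefs.LensSequence.seq L (n ℤ.+ ℤ.1ℤ))) (Field.0# F)))
  → Field._≈_ F (FieldDefs.LensSequence.α L)
      (Field._+_ F
        (FieldDefs.div F (FieldDefs.LensSequence.seq L (n ℤ.- ℤ.1ℤ)) (FieldDefs.LensSequence.seq L n)
          (FieldDefs.nz-left F _ _ h))
        (FieldDefs.div F (FieldDefs.LensSequence.seq L (n ℤ.+ ℤ.+ 2)) (FieldDefs.LensSequence.seq L (n ℤ.+ ℤ.1ℤ))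
          (FieldDefs.nz-right F _ _ h)))
proposition4p6 F L n h =
  cross-products⇒quotient-sum _ _ _ _ _ _ (inv-inverse _ _) (inv-inverse _ _)
    (neighbour-cross-products _ _ _ _ (invariantAt≈0 n)
      (sum-of-neighbours (n≡n-1+1 n) ≡.refl)
      (sum-of-neighbours ≡.refl (n+2≡n+1+1 n)))
  where
    open Field F
    open LensAlgebra F
    open LensSequenceProperties F L

    n≡n-1+1 : ∀ i → i ≡ i ℤ.- 1ℤ ℤ.+ 1ℤ
    n≡n-1+1 = solve-∀
    n+2≡n+1+1 : ∀ i → i ℤ.+ ℤ.+ 2 ≡ i ℤ.+ 1ℤ ℤ.+ 1ℤ
    n+2≡n+1+1 = solve-∀
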